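{- The solver $SAT_{\mathcal{RQ}}$ can be implemented so as to terminate on every conjunction of pure $\Phi_\exists$ constraints, i.e. on every finite conjunction of constraints of the form $exists(x_1\in A_1, exists(x_2\in A_2,\dots exists(x_n\in A_n,\phi)\dots))$ with $n\ge1$, $x_i$ control terms, $A_i$ extensional set terms and $\phi$ an $\mathcal{X}$-formula.
   Context: Setting. $\mathcal{X}$ is a first-order theory with admissible quantifier-free $\mathcal{X}$-formulas (including $=_\mathcal{X}$ and a pairing symbol) and a decision procedure $SAT_\mathcal{X}$. Standing assumptions: set and element variables are disjoint sorts, and $\mathcal{X}$'s predicates are disjoint from the set predicates $=_\mathcal{S},\in,\subseteq$. In $\mathcal{L}_{\mathcal{RQ}}(\mathcal{X})$: control terms are element variables or nested pairs of control terms (distinct variables); extensional set terms are $\varnothing$, set variables, and $\{e\sqcup E\}$ (meaning $\{e\}\cup E$). $exists(c\in A,\phi)$ abbreviates $n\in A\land\phi(n)$, where $n$ is a term whose variables are fresh; $foreach(c\in A,\phi)$ abbreviates $A\subseteq\{c:A\mid\phi\}$. Solver $SAT_{\mathcal{RQ}}$: repeatedly applies non-deterministic rewrite rules to set constraints until a fixpoint (first applicable rule in listed order; disjunctive right sides branch; $N$ fresh), then calls $SAT_\mathcal{X}$ on the $\mathcal{X}$-part. Rules ($\dot A$ a variable): $\varnothing\subseteq\{x:\varnothing\mid\phi\}\to true$; $\{a\sqcup A\}\subseteq\{x:\{a\sqcup A\}\mid\phi(x)\}\to\phi(a)\land A\subseteq\{x:A\mid\phi(x)\}$; $\dot A\subseteq\{x:\dot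 A\mid\phi\}$ irreducible; $a\in\varnothing\to false$; $a\in\{b\sqcup A\}\to a=_\mathcal{X}b\lor a\in A$; $a\in\dot A\to\dot A=\{a\sqcup N\}$; $\varnothing=\varnothing\to true$; $\dot A=\dot A\to true$; $B=\dot A\to\dot A=B$ if $B$ not a variable; $\dot A=B\to\dot A=B$ and substitute $B$ for $\dot A$ elsewhere; $\{a\sqcup A\}=\varnothing\to false$; $\varnothing=\{a\sqcup A\}\to false$; $\{a\sqcup A\}=\{b\sqcup B\}\to(a=_\mathcal{X}b\land A=B)\lor(a=_\mathcal{X}b\land\{a\sqcup A\}=B)\lor(a=_\mathcal{X}b\land A=\{b\sqcup B\})\lor(A=\{b\sqcup N\}\land B=\{a\sqcup N\})$; $\dot A=B$ irreducible if $\dot A$ occurs nowhere else. "Terminates" means every non-deterministic branch terminates. -}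

module Defs where

open import Data.Nat using (ℕ; _≟_)
open import Data.List using (List; []; _∷_; _++_; length; concat)
open import Data.List.Membership.Propositional using (_∈_; _∉_)
open import Data.List.Membership.DecPropositional _≟_ using (_∈?_)
open import Data.List.Relation.Unary.All using (All)
open import Data.List.Relation.Unary.Unique.Propositional using (Unique)
open import Data.Maybe using (Maybe; just; nothing)
open import Data.Product using (Σ; ∃; _×_; _,_)
open import Relation.Nullary using (¬_; does)
open import Relation.Binary.PropositionalEquality using (_≡_; _≢_)
open import Data.Bool using (if_then_else_)
open import Induction.WellFounded using (Acc)

-- The parameter theory X (only what the statement needs).
-- Element variables are natural numbers; set variables are natural
-- numbers of a separate syntactic category (disjoint sorts).

record Theory : Set₁ where
  field
    Term  : Set
    Form  : Set
    var   : ℕ → Term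
    pair  : Term → Term → Term
    _≐_   : Term → Term → Form
    renT  : (ℕ → ℕ) → Term → Term
    renF  : (ℕ → ℕ) → Form → Form

module _ (X : Theory) where
  open Theory X

  data Ctrl : Set where
    cv : ℕ → Ctrl
    cp : Ctrl → Ctrl → Ctrl

  ctrlVars : Ctrl → List ℕ
  ctrlVars (cv v)   = v ∷ []
  ctrlVars (cp c d) = ctrlVars c ++ ctrlVars d

  ctrlTerm : Ctrl → Term
  ctrlTerm (cv v)   = var v
  ctrlTerm (cp c d) = pair (ctrlTerm c) (ctrlTerm d)

  renCtrl : (ℕ → ℕ) → Ctrl → Ctrl
  renCtrl ρ (cv v)   = cv (ρ v)
  renCtrl ρ (cp c d) = cp (renCtrl ρ c) (renCtrl ρ d)

  data SetT : Set where
    emp  : SetT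
    svar : ℕ → SetT
    ins  : Term → SetT → SetT

  renS : (ℕ → ℕ) → SetT → SetT
  renS σ emp       = emp
  renS σ (svar N)  = svar N
  renS σ (ins e E) = ins (renT σ e) (renS σ E)

  -- pure Φ∃ formulas  exists(x₁∈A₁, … exists(xₙ∈Aₙ, φ) …), n ≥ 1
  data PE : Set where
    one : Ctrl → SetT → Form → PE
    ex  : Ctrl → SetT → PE → PE

  WellFormed : PE → Set
  WellFormed (one c A φ) = Unique (ctrlVars c)
  WellFormed (ex c A p)  = Unique (ctrlVars c) × WellFormed p

  -- Constraints handled by SAT_RQ (subset constraints never occur for
  -- pure Φ∃ inputs and are not produced by any rule, so they are omitted)

  data Con : Set where
    mem : Term → SetT → Con
    eqS : SetT → SetT → Con
    xc  : Form → Con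
    ff  : Con

  Config : Set
  Config = List Con

  -- Unfolding of exists:  exists(c∈A, φ) = n ∈ A ∧ φ(n), where n is c
  -- with its variables renamed by ρ.  σ is the renaming accumulated from
  -- the enclosing exists.

  upd : Ctrl → (ℕ → ℕ) → (ℕ → ℕ) → (ℕ → ℕ)
  upd c ρ σ v = if does (v ∈? ctrlVars c) then ρ v else σ v

  data Unf (σ : ℕ → ℕ) : PE → Config → Set where
    u-one : ∀ c A φ (ρ : ℕ → ℕ) →
            Unf σ (one c A φ)
              (mem (ctrlTerm (renCtrl ρ c)) (renS σ A) ∷ xc (renF (upd c ρ σ) φ) ∷ [])
    u-ex  : ∀ c A p (ρ : ℕ → ℕ) {cs} → Unf (upd c ρ σ) p cs →
            Unf σ (ex c A p) (mem (ctrlTerm (renCtrl ρ c)) (renS σ A) ∷ cs)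

  data UnfAll : List PE → Config → Set where
    []  : UnfAll [] []
    _∷_ : ∀ {p ps cs ds} → Unf (λ v → v) p cs → UnfAll ps ds → UnfAll (p ∷ ps) (cs ++ ds)

  svarsS : SetT → List ℕ
  svarsS emp       = []
  svarsS (svar N)  = N ∷ []
  svarsS (ins e E) = svarsS E

  svarsC : Con → List ℕ
  svarsC (mem a A) = svarsS A
  svarsC (eqS A B) = svarsS A ++ svarsS B
  svarsC (xc φ)    = []
  svarsC ff        = []

  svars : Config → List ℕ
  svars []       = []
  svars (k ∷ ks) = svarsC k ++ svars ks

  substS : ℕ → SetT → SetT → SetT
  substS N B emp       = emp
  substS N B (svar M)  = if does (M ≟ N) then B else svar M
  substS N B (ins e E) = ins e (substS N B E)

  substC : ℕ → SetT → Con → Con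
  substC N B (mem a A) = mem a (substS N B A)
  substC N B (eqS A C) = eqS (substS N B A) (substS N B C)
  substC N B (xc φ)    = xc φ
  substC N B ff        = ff

  substL : ℕ → SetT → Config → Config
  substL N B []       = []
  substL N B (k ∷ ks) = substC N B k ∷ substL N B ks

  -- Rew pre post k c' : rewriting the constraint k of
  -- the configuration  pre ++ k ∷ post  (by its first applicable rule)
  -- can yield c' (one constructor per disjunct; fresh N ranges over all
  -- set variables not occurring in the configuration).

  data Rew (pre post : Config) : Con → Config → Set where
    r-memEmp : ∀ {a} → Rew pre post (mem a emp) (pre ++ ff ∷ post)
    r-memIns₁ : ∀ {a b A} → Rew pre post (mem a (ins b A)) (pre ++ xc (a ≐ b) ∷ post)
    r-memIns₂ : ∀ {a b A} → Rew pre post (mem a (ins b A)) (pre ++ mem a A ∷ post)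
    r-memVar : ∀ {a M N} → N ∉ svars (pre ++ mem a (svar M) ∷ post) →
               Rew pre post (mem a (svar M)) (pre ++ eqS (svar M) (ins a (svar N)) ∷ post)
    r-eqEE : Rew pre post (eqS emp emp) (pre ++ post)
    r-eqVV : ∀ {M} → Rew pre post (eqS (svar M) (svar M)) (pre ++ post)
    r-swapE : ∀ {M} → Rew pre post (eqS emp (svar M)) (pre ++ eqS (svar M) emp ∷ post)
    r-swapI : ∀ {a A M} → Rew pre post (eqS (ins a A) (svar M)) (pre ++ eqS (svar M) (ins a A) ∷ post)
    r-subst : ∀ {M B} → B ≢ svar M → M ∈ svars (pre ++ post) →
              Rew pre post (eqS (svar M) B)
                (substL M B pre ++ eqS (svar M) B ∷ substL M B post)
    r-insEmp : ∀ {a A} → Rew pre post (eqS (ins a A) emp) (pre ++ ff ∷ post)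
    r-empIns : ∀ {a A} → Rew pre post (eqS emp (ins a A)) (pre ++ ff ∷ post)
    r-insIns₁ : ∀ {a A b B} → Rew pre post (eqS (ins a A) (ins b B))
                  (pre ++ xc (a ≐ b) ∷ eqS A B ∷ post)
    r-insIns₂ : ∀ {a A b B} → Rew pre post (eqS (ins a A) (ins b B))
                  (pre ++ xc (a ≐ b) ∷ eqS (ins a A) B ∷ post)
    r-insIns₃ : ∀ {a A b B} → Rew pre post (eqS (ins a A) (ins b B))
                  (pre ++ xc (a ≐ b) ∷ eqS A (ins b B) ∷ post)
    r-insIns₄ : ∀ {a A b B N} → N ∉ svars (pre ++ eqS (ins a A) (ins b B) ∷ post) →
                Rew pre post (eqS (ins a A) (ins b B))
                  (pre ++ eqS A (ins b (svar N)) ∷ eqS B (ins a (svar N)) ∷ post)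

  StepAt : Config → ℕ → Config → Set
  StepAt c i c' = Σ Config λ pre → Σ Config λ post → Σ Con λ k →
                  c ≡ pre ++ k ∷ post × length pre ≡ i × Rew pre post k c'

  Applicable : Config → ℕ → Set
  Applicable c i = ∃ λ c' → StepAt c i c'

  Reducible : Config → Set
  Reducible c = ∃ λ i → Applicable c i

  -- An implementation: a (deterministic) choice of which constraint to
  -- rewrite next; it must pick a rewritable constraint whenever one exists.

  record Strategy : Set where
    field
      select   : Config → Maybe ℕ
      sound    : ∀ c i → select c ≡ just i → Applicable c i
      complete : ∀ c → Reducible c → ∃ λ i → select c ≡ just i

  open Strategy

  SStep : Strategy → Config → Config → Set
  SStep st c c' = ∃ λ i → select st c ≡ just i × StepAt c i c'

  -- every non-deterministic branch of the computation from c is finite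
  Terminates : Strategy → Config → Set
  Terminates st c = Acc (λ c' c₀ → SStep st c₀ c') c

{-# OPTIONS --safe #-}
-- The strategy rewrites the first rewritable equation if there is one, and
-- otherwise the first rewritable constraint.  The unfolded input has only
-- ∈-constraints and X-constraints, and the only equations ever created are
-- M = {a ⊔ N}, N fresh, by the rule a ∈ M → M = {a ⊔ N}.  Such an equation is
-- rewritten at once, substituting {a ⊔ N} for M everywhere else; afterwards M
-- occurs only in it, so no equation is rewritable any more.  Thus every
-- configuration is in solved form up to at most one pending equation, and each
-- step decreases, lexicographically, (number of ∈-constraints, whether an
-- equation is rewritable, total number of elements listed in the sets of
-- ∈-constraints): the ∈-rules remove an ∈-constraint or drop an element of its
-- set, while the substitution keeps the ∈-constraints and leaves no rewritable
-- equation, even though it may enlarge their sets.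
module Submission where

open import Defs
open import Algebra.Properties.CommutativeSemigroup using (x∙yz≈y∙xz)
open import Data.Bool using (true; false; if_then_else_; T)
open import Data.Empty using (⊥; ⊥-elim)
open import Data.List using (List; []; _∷_; _++_; length; map; [_])
open import Data.List.Extrema.Nat using (max; xs≤max)
open import Data.List.Membership.Propositional using (_∈_; _∉_)
open import Data.List.Membership.Propositional.Properties using (∈-++⁺ˡ; ∈-++⁺ʳ; ∈-insert)
open import Data.List.Properties using (++-assoc; ++-identityʳ; ∷-injectiveˡ; ∷-injectiveʳ; map-++)
open import Data.List.Relation.Unary.All as All using (All; []; _∷_)
import Data.List.Relation.Unary.All.Properties as Allₚ
open import Data.List.Relation.Unary.Any using (here; there)
open import Data.Maybe using (Maybe; just; nothing; _<∣>_; maybe′)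
open import Data.Maybe.Properties using (just-injective)
open import Data.Nat using (ℕ; suc; _+_; _≤_; _<_; z≤n; s≤s; _≟_; _≡ᵇ_)
open import Data.List.Membership.DecPropositional _≟_ using (_∈?_)
open import Data.Nat.Induction using (<-wellFounded)
open import Data.Nat.ListAction using (sum)
open import Data.Nat.ListAction.Properties using (sum-++)
open import Data.Nat.Properties
  using (+-commutativeSemigroup; +-comm; +-assoc; +-mono-≤; +-monoˡ-≤; +-monoˡ-<;
         ≤-refl; ≤-trans; ≤-reflexive; 1+n≰n; suc-injective; ≡ᵇ⇒≡; ≡⇒≡ᵇ)
open import Data.Product using (Σ; ∃; _×_; _,_)
open import Data.Product.Relation.Binary.Lex.Strict using (×-Lex; ×-wellFounded)
open import Data.Sum using (_⊎_; inj₁; inj₂; [_,_]′)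
open import Data.Unit using (⊤; tt)
open import Function using (_∘_; id; const; case_of_)
open import Induction.WellFounded using (Acc; acc; WellFounded)
open import Relation.Nullary using (¬_; Dec; yes; no; does)
open import Relation.Nullary.Decidable using (_×-dec_)
open import Relation.Binary.PropositionalEquality
  using (_≡_; _≢_; refl; sym; trans; cong; cong₂; subst; subst₂; module ≡-Reasoning)

open ≡-Reasoning

count : ℕ → List ℕ → ℕ
count K []       = 0
count K (x ∷ xs) with K ≟ x
... | yes _ = suc (count K xs)
... | no  _ = count K xs

count-++ : ∀ K xs ys → count K (xs ++ ys) ≡ count K xs + count K ys
count-++ K []       ys = refl
count-++ K (x ∷ xs) ys with K ≟ x
... | yes _ = cong suc (count-++ K xs ys)
... | no  _ = count-++ K xs ys

count-here : ∀ K xs → count K (K ∷ xs) ≡ suc (count K xs)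
count-here K xs with K ≟ K
... | yes _   = refl
... | no  K≢K = ⊥-elim (K≢K refl)

count-there : ∀ {K x} xs → K ≢ x → count K (x ∷ xs) ≡ count K xs
count-there {K} {x} xs K≢x with K ≟ x
... | yes K≡x = ⊥-elim (K≢x K≡x)
... | no  _   = refl

count-first-of-two : ∀ {M N} → M ≢ N → count M (M ∷ N ∷ []) ≡ 1
count-first-of-two {M} {N} M≢N = trans (count-here M [ N ]) (cong suc (count-there [] M≢N))

∈⇒count>0 : ∀ {K xs} → K ∈ xs → 0 < count K xs
∈⇒count>0 {K} {x ∷ xs} (here refl) = subst (0 <_) (sym (count-here K xs)) (s≤s z≤n)
∈⇒count>0 {K} {x ∷ xs} (there K∈xs) with K ≟ x
... | yes _ = s≤s z≤n
... | no  _ = ∈⇒count>0 K∈xs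

∉⇒count≡0 : ∀ {K} xs → K ∉ xs → count K xs ≡ 0
∉⇒count≡0 []       _     = refl
∉⇒count≡0 {K} (x ∷ xs) K∉ with K ≟ x
... | yes K≡x = ⊥-elim (K∉ (here K≡x))
... | no  _   = ∉⇒count≡0 xs (K∉ ∘ there)

-- Like substS in Defs; does (v ≟ M) computes to v ≡ᵇ M, which is what the
-- proofs below split on.
redirect : ℕ → ℕ → ℕ → ℕ
redirect M N v = if does (v ≟ M) then N else v

≡ᵇ-true : ∀ {m n} → (m ≡ᵇ n) ≡ true → m ≡ n
≡ᵇ-true {m} {n} eq = ≡ᵇ⇒≡ m n (subst T (sym eq) tt)

≡ᵇ-false : ∀ {m n} → (m ≡ᵇ n) ≡ false → m ≢ n
≡ᵇ-false {m} {n} eq m≡n = subst T eq (≡⇒≡ᵇ m n m≡n)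

count-map-redirect : ∀ {K M N} xs → K ≢ M → K ≢ N →
                     count K (map (redirect M N) xs) ≡ count K xs
count-map-redirect         []       _   _   = refl
count-map-redirect {K} {M} (x ∷ xs) K≢M K≢N with x ≡ᵇ M in x≡ᵇM
... | true  = begin
  count K (_ ∷ map (redirect _ _) xs)  ≡⟨ count-there _ K≢N ⟩
  count K (map (redirect _ _) xs)      ≡⟨ count-map-redirect xs K≢M K≢N ⟩
  count K xs                           ≡⟨ count-there xs (λ K≡x → K≢M (trans K≡x (≡ᵇ-true x≡ᵇM))) ⟨
  count K (x ∷ xs)                     ∎
... | false with K ≟ x
...   | yes _ = cong suc (count-map-redirect xs K≢M K≢N)
...   | no  _ = count-map-redirect xs K≢M K≢N

count-map-redirect-source : ∀ {M N} xs → M ≢ N → count M (map (redirect M N) xs) ≡ 0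
count-map-redirect-source     []       _   = refl
count-map-redirect-source {M} {N} (x ∷ xs) M≢N with x ≡ᵇ M in x≡ᵇM
... | true  = trans (count-there {M} {N} _ M≢N) (count-map-redirect-source xs M≢N)
... | false = trans (count-there {M} {x} _ (≡ᵇ-false x≡ᵇM ∘ sym))
                    (count-map-redirect-source xs M≢N)

fresh : List ℕ → ℕ
fresh xs = suc (max 0 xs)

fresh-∉ : ∀ xs → fresh xs ∉ xs
fresh-∉ xs m = 1+n≰n (All.lookup (xs≤max 0 xs) m)

total : {A : Set} → (A → ℕ) → List A → ℕ
total w xs = sum (map w xs)

module _ {A : Set} (w : A → ℕ) where

  total-++ : ∀ xs ys → total w (xs ++ ys) ≡ total w xs + total w ys
  total-++ xs ys = trans (cong sum (map-++ w xs ys)) (sum-++ (map w xs) (map w ys))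

  total-split : ∀ pre k post → total w (pre ++ k ∷ post) ≡ w k + total w (pre ++ post)
  total-split pre k post = begin
    total w (pre ++ k ∷ post)           ≡⟨ total-++ pre (k ∷ post) ⟩
    total w pre + (w k + total w post)  ≡⟨ x∙yz≈y∙xz +-commutativeSemigroup (total w pre) (w k) _ ⟩
    w k + (total w pre + total w post)  ≡⟨ cong (w k +_) (total-++ pre post) ⟨
    w k + total w (pre ++ post)         ∎

  total-replace-< : ∀ pre post {k k'} → w k' < w k →
                    total w (pre ++ k' ∷ post) < total w (pre ++ k ∷ post)
  total-replace-< pre post {k} {k'} lt =
    subst₂ _<_ (sym (total-split pre k' post)) (sym (total-split pre k post))
      (+-monoˡ-< (total w (pre ++ post)) lt)

  total-replace-≡ : ∀ pre post {k k'} → w k' ≡ w k →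
                    total w (pre ++ k' ∷ post) ≡ total w (pre ++ k ∷ post)
  total-replace-≡ pre post {k} {k'} eq = begin
    total w (pre ++ k' ∷ post)    ≡⟨ total-split pre k' post ⟩
    w k' + total w (pre ++ post)  ≡⟨ cong (_+ total w (pre ++ post)) eq ⟩
    w k + total w (pre ++ post)   ≡⟨ total-split pre k post ⟨
    total w (pre ++ k ∷ post)     ∎

split-unique : ∀ {A : Set} (pre : List A) {k post} pre' {k' post'} →
               pre ++ k ∷ post ≡ pre' ++ k' ∷ post' → length pre ≡ length pre' → k ≡ k'
split-unique []        []         eq _   = ∷-injectiveˡ eq
split-unique (_ ∷ pre) (_ ∷ pre') eq len = split-unique pre pre' (∷-injectiveʳ eq) (suc-injective len)
split-unique []        (_ ∷ _)    _  ()
split-unique (_ ∷ _)   []         _  ()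

module _ {A : Set} {P : A → Set} where

  All-at : ∀ pre {k post} → All P (pre ++ k ∷ post) → P k
  All-at pre = All.head ∘ Allₚ.++⁻ʳ pre

  All-delete : ∀ pre {k post} → All P (pre ++ k ∷ post) → All P (pre ++ post)
  All-delete pre ps = Allₚ.++⁺ (Allₚ.++⁻ˡ pre ps) (All.tail (Allₚ.++⁻ʳ pre ps))

module _ {A : Set} {P Q : A → Set} where

  All-replace : ∀ pre {k k' post} → (∀ {x} → P x → Q x) → Q k' →
                All P (pre ++ k ∷ post) → All Q (pre ++ k' ∷ post)
  All-replace pre f qk' ps =
    Allₚ.++⁺ (All.map f (Allₚ.++⁻ˡ pre ps)) (qk' ∷ All.map f (All.tail (Allₚ.++⁻ʳ pre ps)))

-- first pre rest is the index, in pre ++ rest, of the first k in rest that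
-- satisfies D in its context; pre accumulates the elements already passed.
module FirstPosition {A : Set} (D : List A → List A → A → Set)
                     (D? : ∀ pre post k → Dec (D pre post k)) where

  first : List A → List A → Maybe ℕ
  first pre []         = nothing
  first pre (k ∷ post) with D? pre post k
  ... | yes _ = just (length pre)
  ... | no  _ = first (pre ++ [ k ]) post

  first-sound : ∀ pre rest {i} → first pre rest ≡ just i →
                ∃ λ pre' → ∃ λ post' → ∃ λ k →
                  pre ++ rest ≡ pre' ++ k ∷ post' × length pre' ≡ i × D pre' post' k
  first-sound pre (k ∷ post) found with D? pre post k
  ... | yes d = pre , post , k , refl , just-injective found , d
  ... | no  _ with first-sound (pre ++ [ k ]) post found
  ...   | pre' , post' , k' , split , at , d =
            pre' , post' , k' , trans (sym (++-assoc pre [ k ] post)) split , at , d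

  first-complete : ∀ pre r₁ {k r₂} → first pre (r₁ ++ k ∷ r₂) ≡ nothing → ¬ D (pre ++ r₁) r₂ k
  first-complete pre [] {k} {r₂} none d with D? pre r₂ k
  ... | yes _  = case none of λ ()
  ... | no  ¬d = ¬d (subst (λ p → D p r₂ k) (++-identityʳ pre) d)
  first-complete pre (x ∷ r₁) {k} {r₂} none d with D? pre (r₁ ++ k ∷ r₂) x
  ... | yes _ = case none of λ ()
  ... | no  _ = first-complete (pre ++ [ x ]) r₁ none
                  (subst (λ p → D p r₂ k) (sym (++-assoc pre [ x ] r₁)) d)

Measure : Set
Measure = ℕ × ℕ × ℕ

_⊏_ : Measure → Measure → Set
_⊏_ = ×-Lex _≡_ _<_ (×-Lex _≡_ _<_ _<_)

⊏-wellFounded : WellFounded _⊏_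
⊏-wellFounded = ×-wellFounded <-wellFounded (×-wellFounded <-wellFounded <-wellFounded)

module _ (X : Theory) where
  open Theory X

  occurrences : ℕ → Config X → ℕ
  occurrences K c = count K (svars X c)

  svars-++ : ∀ xs ys → svars X (xs ++ ys) ≡ svars X xs ++ svars X ys
  svars-++ []       ys = refl
  svars-++ (k ∷ xs) ys = trans (cong (svarsC X k ++_) (svars-++ xs ys))
                               (sym (++-assoc (svarsC X k) (svars X xs) (svars X ys)))

  svarsC⊆svars : ∀ {K k c} → k ∈ c → K ∈ svarsC X k → K ∈ svars X c
  svarsC⊆svars {c = k ∷ c} (here refl) K∈k = ∈-++⁺ˡ K∈k
  svarsC⊆svars {c = k ∷ c} (there k∈c) K∈k = ∈-++⁺ʳ (svarsC X k) (svarsC⊆svars k∈c K∈k)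

  occurrences-++ : ∀ K xs ys → occurrences K (xs ++ ys) ≡ occurrences K xs + occurrences K ys
  occurrences-++ K xs ys =
    trans (cong (count K) (svars-++ xs ys)) (count-++ K (svars X xs) (svars X ys))

  occurrences-split : ∀ K pre k post →
    occurrences K (pre ++ k ∷ post) ≡ count K (svarsC X k) + occurrences K (pre ++ post)
  occurrences-split K pre k post = begin
    occurrences K (pre ++ k ∷ post)
      ≡⟨ occurrences-++ K pre (k ∷ post) ⟩
    occurrences K pre + count K (svarsC X k ++ svars X post)
      ≡⟨ cong (occurrences K pre +_) (count-++ K (svarsC X k) (svars X post)) ⟩
    occurrences K pre + (count K (svarsC X k) + occurrences K post)
      ≡⟨ x∙yz≈y∙xz +-commutativeSemigroup (occurrences K pre) (count K (svarsC X k)) _ ⟩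
    count K (svarsC X k) + (occurrences K pre + occurrences K post)
      ≡⟨ cong (count K (svarsC X k) +_) (occurrences-++ K pre post) ⟨
    count K (svarsC X k) + occurrences K (pre ++ post)
      ∎

  at-most-once⇒¬shared : ∀ {K} pre {k} post → occurrences K (pre ++ k ∷ post) ≤ 1 →
                         K ∈ svarsC X k → K ∉ svars X (pre ++ post)
  at-most-once⇒¬shared {K} pre {k} post once K∈k K∈rest = 1+n≰n twice
    where
    twice : 2 ≤ 1
    twice = ≤-trans (subst (2 ≤_) (sym (occurrences-split K pre k post))
                                 (+-mono-≤ (∈⇒count>0 K∈k) (∈⇒count>0 K∈rest)))
                          once

  substL-++ : ∀ M B xs ys → substL X M B (xs ++ ys) ≡ substL X M B xs ++ substL X M B ys
  substL-++ M B []       ys = refl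
  substL-++ M B (k ∷ xs) ys = cong (substC X M B k ∷_) (substL-++ M B xs ys)

  svarsS-substS : ∀ M a N A →
    svarsS X (substS X M (ins a (svar N)) A) ≡ map (redirect M N) (svarsS X A)
  svarsS-substS M a N emp       = refl
  svarsS-substS M a N (svar v) with v ≡ᵇ M
  ... | true  = refl
  ... | false = refl
  svarsS-substS M a N (ins e E) = svarsS-substS M a N E

  svarsC-substC : ∀ M a N k →
    svarsC X (substC X M (ins a (svar N)) k) ≡ map (redirect M N) (svarsC X k)
  svarsC-substC M a N (mem b A) = svarsS-substS M a N A
  svarsC-substC M a N (eqS A C) =
    trans (cong₂ _++_ (svarsS-substS M a N A) (svarsS-substS M a N C))
          (sym (map-++ (redirect M N) (svarsS X A) (svarsS X C)))
  svarsC-substC M a N (xc φ)    = refl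
  svarsC-substC M a N ff        = refl

  svars-substL : ∀ M a N ks →
    svars X (substL X M (ins a (svar N)) ks) ≡ map (redirect M N) (svars X ks)
  svars-substL M a N []       = refl
  svars-substL M a N (k ∷ ks) =
    trans (cong₂ _++_ (svarsC-substC M a N k) (svars-substL M a N ks))
          (sym (map-++ (redirect M N) (svarsC X k) (svars X ks)))

  occurrences-substituted : ∀ K M a N pre k post →
    occurrences K (substL X M (ins a (svar N)) pre ++ k ∷ substL X M (ins a (svar N)) post)
      ≡ count K (svarsC X k) + count K (map (redirect M N) (svars X (pre ++ post)))
  occurrences-substituted K M a N pre k post = begin
    occurrences K (substL X M B pre ++ k ∷ substL X M B post)
      ≡⟨ occurrences-split K (substL X M B pre) k (substL X M B post) ⟩
    count K (svarsC X k) + occurrences K (substL X M B pre ++ substL X M B post)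
      ≡⟨ cong (λ ks → count K (svarsC X k) + occurrences K ks) (substL-++ M B pre post) ⟨
    count K (svarsC X k) + occurrences K (substL X M B (pre ++ post))
      ≡⟨ cong (λ vs → count K (svarsC X k) + count K vs) (svars-substL M a N (pre ++ post)) ⟩
    count K (svarsC X k) + count K (map (redirect M N) (svars X (pre ++ post)))
      ∎
    where
    B : SetT X
    B = ins a (svar N)

  -- Only equations M = {a ⊔ A} ever arise; such an equation is solved when M
  -- occurs nowhere else, so that the substitution rule no longer applies to it.
  Solved : Config X → Con X → Set
  Solved c (mem _ _)                = ⊤
  Solved c (xc _)                   = ⊤
  Solved c ff                       = ⊤
  Solved c (eqS (svar M) (ins _ _)) = occurrences M c ≤ 1
  Solved c (eqS _ _)                = ⊥

  SolvedForm : Config X → Set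
  SolvedForm c = All (Solved c) c

  Solved-transfer : ∀ {c c'} → (∀ {K} → occurrences K c ≤ 1 → occurrences K c' ≤ 1) →
                    ∀ {k} → Solved c k → Solved c' k
  Solved-transfer h {mem _ _}                s  = tt
  Solved-transfer h {xc _}                   s  = tt
  Solved-transfer h {ff}                     s  = tt
  Solved-transfer h {eqS (svar M) (ins _ _)} s  = h s
  Solved-transfer h {eqS emp _}              ()
  Solved-transfer h {eqS (ins _ _) _}        ()
  Solved-transfer h {eqS (svar _) emp}       ()
  Solved-transfer h {eqS (svar _) (svar _)}  ()

  expansion : ℕ → Term → ℕ → Con X
  expansion M a N = eqS (svar M) (ins a (svar N))

  record PendingForm (c : Config X) : Set where
    constructor pending
    field
      pre post : Config X
      M N      : ℕ
      a        : Term
      at       : c ≡ pre ++ expansion M a N ∷ post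
      M≢N      : M ≢ N
      N-once   : occurrences N c ≤ 1
      others   : All (λ k → Solved c k ⊎ k ≡ expansion M a N) c

  Invariant : Config X → Set
  Invariant c = SolvedForm c ⊎ PendingForm c

  IsEquation : Con X → Set
  IsEquation (eqS _ _) = ⊤
  IsEquation (mem _ _) = ⊥
  IsEquation (xc _)    = ⊥
  IsEquation ff        = ⊥

  isEquation? : ∀ k → Dec (IsEquation k)
  isEquation? (eqS _ _) = yes tt
  isEquation? (mem _ _) = no λ ()
  isEquation? (xc _)    = no λ ()
  isEquation? ff        = no λ ()

  Rewritable : Config X → Config X → Con X → Set
  Rewritable pre post k = ∃ (Rew X pre post k)

  rewritable? : ∀ pre post k → Dec (Rewritable pre post k)
  rewritable? pre post (mem a emp)       = yes (_ , r-memEmp)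
  rewritable? pre post (mem a (ins b A)) = yes (_ , r-memIns₁)
  rewritable? pre post (mem a (svar M))  =
    yes (_ , r-memVar (fresh-∉ (svars X (pre ++ mem a (svar M) ∷ post))))
  rewritable? pre post (eqS emp emp)             = yes (_ , r-eqEE)
  rewritable? pre post (eqS emp (svar M))        = yes (_ , r-swapE)
  rewritable? pre post (eqS emp (ins a A))       = yes (_ , r-empIns)
  rewritable? pre post (eqS (ins a A) emp)       = yes (_ , r-insEmp)
  rewritable? pre post (eqS (ins a A) (svar M))  = yes (_ , r-swapI)
  rewritable? pre post (eqS (ins a A) (ins b B)) = yes (_ , r-insIns₁)
  rewritable? pre post (eqS (svar M) emp) with M ∈? svars X (pre ++ post)
  ... | yes M∈ = yes (_ , r-subst (λ ()) M∈)
  ... | no  M∉ = no λ { (_ , r-subst _ M∈) → M∉ M∈ }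
  rewritable? pre post (eqS (svar M) (ins a A)) with M ∈? svars X (pre ++ post)
  ... | yes M∈ = yes (_ , r-subst (λ ()) M∈)
  ... | no  M∉ = no λ { (_ , r-subst _ M∈) → M∉ M∈ }
  rewritable? pre post (eqS (svar M) (svar M')) with M' ≟ M
  ... | yes refl = yes (_ , r-eqVV)
  ... | no  M'≢M with M ∈? svars X (pre ++ post)
  ...   | yes M∈ = yes (_ , r-subst (λ { refl → M'≢M refl }) M∈)
  ...   | no  M∉ = no λ { (_ , r-eqVV) → M'≢M refl ; (_ , r-subst _ M∈) → M∉ M∈ }
  rewritable? pre post (xc φ) = no λ { (_ , ()) }
  rewritable? pre post ff     = no λ { (_ , ()) }

  RewritableEquation : Config X → Config X → Con X → Set
  RewritableEquation pre post k = IsEquation k × Rewritable pre post k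

  module Equations = FirstPosition RewritableEquation
                       (λ pre post k → isEquation? k ×-dec rewritable? pre post k)
  module Constraints = FirstPosition Rewritable rewritable?

  firstRewritableEquation : Config X → Maybe ℕ
  firstRewritableEquation = Equations.first []

  select : Config X → Maybe ℕ
  select c = firstRewritableEquation c <∣> Constraints.first [] c

  select-sound : ∀ c i → select c ≡ just i → Applicable X c i
  select-sound c i chosen with firstRewritableEquation c in found
  ... | just j with Equations.first-sound [] c found
  ...   | pre , post , k , split , at-j , _ , c' , r =
            c' , pre , post , k , split , trans at-j (just-injective chosen) , r
  select-sound c i chosen | nothing with Constraints.first-sound [] c chosen
  ...   | pre , post , k , split , at-i , c' , r = c' , pre , post , k , split , at-i , r

  select-complete : ∀ c → Reducible X c → ∃ λ i → select c ≡ just i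
  select-complete c (i , c' , pre , post , k , refl , _ , r) with firstRewritableEquation c
  ... | just j = j , refl
  ... | nothing with Constraints.first [] c in none
  ...   | just j  = j , refl
  ...   | nothing = ⊥-elim (Constraints.first-complete [] pre none (c' , r))

  equationsFirst : Strategy X
  equationsFirst = record { select = select ; sound = select-sound ; complete = select-complete }

  insertions : SetT X → ℕ
  insertions emp       = 0
  insertions (svar _)  = 0
  insertions (ins _ A) = suc (insertions A)

  membership : Con X → ℕ
  membership (mem _ _) = 1
  membership (eqS _ _) = 0
  membership (xc _)    = 0
  membership ff        = 0

  membershipSize : Con X → ℕ
  membershipSize (mem _ A) = insertions A
  membershipSize (eqS _ _) = 0
  membershipSize (xc _)    = 0
  membershipSize ff        = 0

  hasRewritableEquation : Config X → ℕ
  hasRewritableEquation c = maybe′ (const 1) 0 (firstRewritableEquation c)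

  measure : Config X → Measure
  measure c = total membership c , hasRewritableEquation c , total membershipSize c

  total-membership-substL : ∀ M B ks → total membership (substL X M B ks) ≡ total membership ks
  total-membership-substL M B []             = refl
  total-membership-substL M B (mem _ _ ∷ ks) = cong suc (total-membership-substL M B ks)
  total-membership-substL M B (eqS _ _ ∷ ks) = total-membership-substL M B ks
  total-membership-substL M B (xc _ ∷ ks)    = total-membership-substL M B ks
  total-membership-substL M B (ff ∷ ks)      = total-membership-substL M B ks

  solved-irreducible : ∀ pre post {k c'} → Solved (pre ++ k ∷ post) k → IsEquation k →
                       ¬ Rew X pre post k c'
  solved-irreducible pre post {eqS (svar M) (ins _ _)} once _ (r-subst _ M∈rest) =
    at-most-once⇒¬shared pre post once (here refl) M∈rest
  solved-irreducible pre post {eqS emp _}             () _ _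
  solved-irreducible pre post {eqS (ins _ _) _}       () _ _
  solved-irreducible pre post {eqS (svar _) emp}      () _ _
  solved-irreducible pre post {eqS (svar _) (svar _)} () _ _
  solved-irreducible pre post {mem _ _}               _ () _
  solved-irreducible pre post {xc _}                  _ () _
  solved-irreducible pre post {ff}                    _ () _

  solved⇒no-rewritable-equation : ∀ {c} → SolvedForm c → firstRewritableEquation c ≡ nothing
  solved⇒no-rewritable-equation {c} solved with firstRewritableEquation c in found
  ... | nothing = refl
  ... | just _ with Equations.first-sound [] c found
  ...   | pre , post , k , refl , _ , isEq , _ , r =
            ⊥-elim (solved-irreducible pre post (All-at pre solved) isEq r)

  solved⇒hasRewritableEquation≡0 : ∀ {c} → SolvedForm c → hasRewritableEquation c ≡ 0
  solved⇒hasRewritableEquation≡0 solved =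
    cong (maybe′ (const 1) 0) (solved⇒no-rewritable-equation solved)

  solved-replace : ∀ pre post {k k'} → (∀ K → count K (svarsC X k') ≤ count K (svarsC X k)) →
                   (∀ {c} → Solved c k') →
                   SolvedForm (pre ++ k ∷ post) → SolvedForm (pre ++ k' ∷ post)
  solved-replace pre post {k} {k'} fewer k'-solved =
    All-replace pre (Solved-transfer still-once) k'-solved
    where
    still-once : ∀ {K} → occurrences K (pre ++ k ∷ post) ≤ 1 →
                 occurrences K (pre ++ k' ∷ post) ≤ 1
    still-once {K} once =
      ≤-trans (subst₂ _≤_ (sym (occurrences-split K pre k' post)) (sym (occurrences-split K pre k post))
                          (+-monoˡ-≤ (occurrences K (pre ++ post)) (fewer K)))
              once

  occurrences-expansion : ∀ K pre post a M N →
    occurrences K (pre ++ expansion M a N ∷ post)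
      ≡ count K [ N ] + occurrences K (pre ++ mem a (svar M) ∷ post)
  occurrences-expansion K pre post a M N = begin
    occurrences K (pre ++ expansion M a N ∷ post)
      ≡⟨ occurrences-split K pre (expansion M a N) post ⟩
    count K ([ M ] ++ [ N ]) + R
      ≡⟨ cong (_+ R) (count-++ K [ M ] [ N ]) ⟩
    (count K [ M ] + count K [ N ]) + R
      ≡⟨ cong (_+ R) (+-comm (count K [ M ]) (count K [ N ])) ⟩
    (count K [ N ] + count K [ M ]) + R
      ≡⟨ +-assoc (count K [ N ]) (count K [ M ]) R ⟩
    count K [ N ] + (count K [ M ] + R)
      ≡⟨ cong (count K [ N ] +_) (occurrences-split K pre (mem a (svar M)) post) ⟨
    count K [ N ] + occurrences K (pre ++ mem a (svar M) ∷ post)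
      ∎
    where
    R : ℕ
    R = occurrences K (pre ++ post)

  expansion-pending : ∀ pre post {a M N} → SolvedForm (pre ++ mem a (svar M) ∷ post) →
                      N ∉ svars X (pre ++ mem a (svar M) ∷ post) →
                      PendingForm (pre ++ expansion M a N ∷ post)
  expansion-pending pre post {a} {M} {N} solved N∉ =
    pending pre post M N a refl M≢N N-once
      (All-replace pre (inj₁ ∘ Solved-transfer still-once) (inj₂ refl) solved)
    where
    M≢N : M ≢ N
    M≢N refl = N∉ (svarsC⊆svars (∈-insert pre) (here refl))
    N-once : occurrences N (pre ++ expansion M a N ∷ post) ≤ 1
    N-once = ≤-reflexive (begin
      occurrences N (pre ++ expansion M a N ∷ post)
        ≡⟨ occurrences-expansion N pre post a M N ⟩
      count N [ N ] + occurrences N (pre ++ mem a (svar M) ∷ post)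
        ≡⟨ cong₂ _+_ (count-here N []) (∉⇒count≡0 _ N∉) ⟩
      1 ∎)
    still-once : ∀ {K} → occurrences K (pre ++ mem a (svar M) ∷ post) ≤ 1 →
                 occurrences K (pre ++ expansion M a N ∷ post) ≤ 1
    still-once {K} once with K ≟ N
    ... | yes refl = N-once
    ... | no  K≢N  = subst (_≤ 1) (sym (trans (occurrences-expansion K pre post a M N)
                                             (cong (_+ _) (count-there [] K≢N))))
                           once

  membership-step : ∀ pre post k {c'} → SolvedForm (pre ++ k ∷ post) → ¬ IsEquation k →
                    Rew X pre post k c' → Invariant c' × measure c' ⊏ measure (pre ++ k ∷ post)
  membership-step pre post (mem a emp) solved _ r-memEmp =
    inj₁ (solved-replace pre post (λ _ → z≤n) tt solved) ,
    inj₁ (total-replace-< membership pre post ≤-refl)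
  membership-step pre post (mem a (ins b A)) solved _ r-memIns₁ =
    inj₁ (solved-replace pre post (λ _ → z≤n) tt solved) ,
    inj₁ (total-replace-< membership pre post ≤-refl)
  membership-step pre post (mem a (ins b A)) solved _ r-memIns₂ =
    inj₁ solved' ,
    inj₂ (total-replace-≡ membership pre post refl ,
          inj₂ (trans (solved⇒hasRewritableEquation≡0 solved')
                      (sym (solved⇒hasRewritableEquation≡0 solved)) ,
                total-replace-< membershipSize pre post ≤-refl))
    where
    solved' : SolvedForm (pre ++ mem a A ∷ post)
    solved' = solved-replace pre post (λ _ → ≤-refl) tt solved
  membership-step pre post (mem a (svar M)) solved _ (r-memVar N∉) =
    inj₂ (expansion-pending pre post solved N∉) ,
    inj₁ (total-replace-< membership pre post ≤-refl)
  membership-step pre post (eqS _ _) _ ¬eq _ = ⊥-elim (¬eq tt)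
  membership-step pre post (xc _)    _ _   ()
  membership-step pre post ff        _ _   ()

  All-substL : ∀ {Q : Con X → Set} M B xs → All (Q ∘ substC X M B) xs → All Q (substL X M B xs)
  All-substL M B []       []       = []
  All-substL M B (k ∷ xs) (q ∷ qs) = q ∷ All-substL M B xs qs

  occurrences-substitution-other : ∀ {K M a N} pre k post → K ≢ M → K ≢ N →
    occurrences K (substL X M (ins a (svar N)) pre ++ k ∷ substL X M (ins a (svar N)) post)
      ≡ occurrences K (pre ++ k ∷ post)
  occurrences-substitution-other {K} {M} {a} {N} pre k post K≢M K≢N = begin
    occurrences K (substL X M B pre ++ k ∷ substL X M B post)
      ≡⟨ occurrences-substituted K M a N pre k post ⟩
    count K (svarsC X k) + count K (map (redirect M N) (svars X (pre ++ post)))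
      ≡⟨ cong (count K (svarsC X k) +_) (count-map-redirect (svars X (pre ++ post)) K≢M K≢N) ⟩
    count K (svarsC X k) + occurrences K (pre ++ post)
      ≡⟨ occurrences-split K pre k post ⟨
    occurrences K (pre ++ k ∷ post)
      ∎
    where
    B : SetT X
    B = ins a (svar N)

  occurrences-substitution-source : ∀ {M a N} pre post → M ≢ N →
    occurrences M (substL X M (ins a (svar N)) pre ++ expansion M a N ∷
                   substL X M (ins a (svar N)) post) ≡ 1
  occurrences-substitution-source {M} {a} {N} pre post M≢N = begin
    occurrences M (substL X M B pre ++ expansion M a N ∷ substL X M B post)
      ≡⟨ occurrences-substituted M M a N pre (expansion M a N) post ⟩
    count M (M ∷ N ∷ []) + count M (map (redirect M N) (svars X (pre ++ post)))
      ≡⟨ cong₂ _+_ (count-first-of-two M≢N)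
                   (count-map-redirect-source (svars X (pre ++ post)) M≢N) ⟩
    1 ∎
    where
    B : SetT X
    B = ins a (svar N)

  substitution-solves : ∀ pre post {M a N} → M ≢ N →
    occurrences N (pre ++ expansion M a N ∷ post) ≤ 1 →
    All (λ k → Solved (pre ++ expansion M a N ∷ post) k ⊎ k ≡ expansion M a N)
        (pre ++ expansion M a N ∷ post) →
    SolvedForm (substL X M (ins a (svar N)) pre ++ expansion M a N ∷ substL X M (ins a (svar N)) post)
  substitution-solves pre post {M} {a} {N} M≢N N-once others =
    Allₚ.++⁺ (All-substL M B pre (Allₚ.++⁻ˡ pre rest))
             (≤-reflexive (occurrences-substitution-source pre post M≢N) ∷
              All-substL M B post (Allₚ.++⁻ʳ pre rest))
    where
    B : SetT X
    B = ins a (svar N)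
    P : Con X
    P = expansion M a N
    c c' : Config X
    c  = pre ++ P ∷ post
    c' = substL X M B pre ++ P ∷ substL X M B post

    shared : ∀ {K k} → k ∈ pre ++ post → occurrences K c ≤ 1 →
             K ∈ svarsC X P → K ∈ svarsC X k → ⊥
    shared k∈ once K∈P K∈k = at-most-once⇒¬shared pre post once K∈P (svarsC⊆svars k∈ K∈k)

    other-than-P : ∀ {k} → k ∈ pre ++ post → Solved c k ⊎ k ≡ P → Solved c k
    other-than-P _  (inj₁ solved) = solved
    other-than-P k∈ (inj₂ refl)   = ⊥-elim (shared k∈ N-once (there (here refl)) (there (here refl)))

    substituted : ∀ {k} → k ∈ pre ++ post → Solved c k → Solved c' (substC X M B k)
    substituted {mem _ _} _ _ = tt
    substituted {xc _}    _ _ = tt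
    substituted {ff}      _ _ = tt
    substituted {eqS (svar M') (ins _ _)} k∈ once with M' ≡ᵇ M in M'≡ᵇM
    ... | true  = ⊥-elim (shared k∈ once (here (≡ᵇ-true M'≡ᵇM)) (here refl))
    ... | false =
      subst (_≤ 1) (sym (occurrences-substitution-other pre P post (≡ᵇ-false M'≡ᵇM) M'≢N)) once
      where
      M'≢N : M' ≢ N
      M'≢N refl = shared k∈ once (there (here refl)) (here refl)
    substituted {eqS emp _}             _ ()
    substituted {eqS (ins _ _) _}       _ ()
    substituted {eqS (svar _) emp}      _ ()
    substituted {eqS (svar _) (svar _)} _ ()

    rest : All (λ k → Solved c' (substC X M B k)) (pre ++ post)
    rest = All.tabulate λ k∈ →
      substituted k∈ (other-than-P k∈ (All.lookup (All-delete pre others) k∈))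

  pending⇒solved : ∀ {c} → PendingForm c → firstRewritableEquation c ≡ nothing → SolvedForm c
  pending⇒solved (pending pre post M N a refl M≢N _ others) none = All.map settle others
    where
    M∉rest : M ∉ svars X (pre ++ post)
    M∉rest M∈ = Equations.first-complete [] pre none (tt , _ , r-subst (λ ()) M∈)

    M-once : occurrences M (pre ++ expansion M a N ∷ post) ≤ 1
    M-once = ≤-reflexive (begin
      occurrences M (pre ++ expansion M a N ∷ post)
        ≡⟨ occurrences-split M pre (expansion M a N) post ⟩
      count M (M ∷ N ∷ []) + occurrences M (pre ++ post)
        ≡⟨ cong₂ _+_ (count-first-of-two M≢N) (∉⇒count≡0 _ M∉rest) ⟩
      1 ∎)

    settle : ∀ {k} → Solved (pre ++ expansion M a N ∷ post) k ⊎ k ≡ expansion M a N →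
             Solved (pre ++ expansion M a N ∷ post) k
    settle (inj₁ solved) = solved
    settle (inj₂ refl)   = M-once

  equation-step : ∀ pre post k {c'} → Invariant (pre ++ k ∷ post) → IsEquation k →
                  Rew X pre post k c' →
                  SolvedForm c' × total membership c' ≡ total membership (pre ++ k ∷ post)
  equation-step pre post k (inj₁ solved) isEq r =
    ⊥-elim (solved-irreducible pre post (All-at pre solved) isEq r)
  equation-step pre post k (inj₂ (pending _ _ M N a _ M≢N N-once others)) isEq r with All-at pre others
  ... | inj₁ solved = ⊥-elim (solved-irreducible pre post solved isEq r)
  ... | inj₂ refl with r
  ...   | r-subst _ _ = substitution-solves pre post M≢N N-once others , memberships-kept
    where
    B : SetT X
    B = ins a (svar N)
    memberships-kept : total membership (substL X M B pre ++ expansion M a N ∷ substL X M B post)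
                         ≡ total membership (pre ++ expansion M a N ∷ post)
    memberships-kept = begin
      total membership (substL X M B pre ++ expansion M a N ∷ substL X M B post)
        ≡⟨ total-++ membership (substL X M B pre) _ ⟩
      total membership (substL X M B pre) + total membership (substL X M B post)
        ≡⟨ cong₂ _+_ (total-membership-substL M B pre) (total-membership-substL M B post) ⟩
      total membership pre + total membership post
        ≡⟨ total-++ membership pre _ ⟨
      total membership (pre ++ expansion M a N ∷ post)
        ∎

  selected-is-equation : ∀ pre post k {j} → firstRewritableEquation (pre ++ k ∷ post) ≡ just j →
                         length pre ≡ j → IsEquation k
  selected-is-equation pre post k found at-j with Equations.first-sound [] _ found
  ... | pre' , _ , _ , split , at-j' , isEq , _ =
          subst IsEquation (split-unique pre' pre (sym split) (trans at-j' (sym at-j))) isEq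

  step-decreases : ∀ {c c'} → Invariant c → SStep X equationsFirst c c' →
                   Invariant c' × measure c' ⊏ measure c
  step-decreases {c} {c'} inv (i , chosen , pre , post , k , refl , at-i , r) =
    by-first-equation (firstRewritableEquation c) refl
    where
    by-first-equation : ∀ m → firstRewritableEquation c ≡ m → Invariant c' × measure c' ⊏ measure c
    by-first-equation (just j) found =
      let solved' , memberships-kept = equation-step pre post k inv is-equation r in
      inj₁ solved' ,
      inj₂ (memberships-kept , inj₁ (subst₂ _<_ (sym (solved⇒hasRewritableEquation≡0 solved'))
                                                (sym (cong (maybe′ (const 1) 0) found)) ≤-refl))
      where
      j≡i : j ≡ i
      j≡i = just-injective (trans (sym (cong (_<∣> Constraints.first [] c) found)) chosen)
      is-equation : IsEquation k
      is-equation = selected-is-equation pre post k found (trans at-i (sym j≡i))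
    by-first-equation nothing found =
      membership-step pre post k ([ id , (λ p → pending⇒solved p found) ]′ inv) not-equation r
      where
      not-equation : ¬ IsEquation k
      not-equation isEq = Equations.first-complete [] pre found (isEq , _ , r)

  terminates : ∀ c → Acc _⊏_ (measure c) → Invariant c → Terminates X equationsFirst c
  terminates c (acc smaller) inv =
    acc λ st → let inv' , decrease = step-decreases inv st in terminates _ (smaller decrease) inv'

  unfolding-solved : ∀ {σ p cs c} → Unf X σ p cs → All (Solved c) cs
  unfolding-solved (u-one _ _ _ _)   = tt ∷ tt ∷ []
  unfolding-solved (u-ex _ _ _ _ u) = tt ∷ unfolding-solved u

  unfoldings-solved : ∀ {ps cs c} → UnfAll X ps cs → All (Solved c) cs
  unfoldings-solved []       = []
  unfoldings-solved (u ∷ us) = Allₚ.++⁺ (unfolding-solved u) (unfoldings-solved us)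

-- Termination does not need the control terms to have distinct variables,
-- so the WellFormed hypothesis is unused.
theorem4 : (X : Theory) → Σ (Strategy X) λ st →
    (ps : List (PE X)) → All (WellFormed X) ps →
    (cs : Config X) → UnfAll X ps cs → Terminates X st cs
theorem4 X = equationsFirst X , λ _ _ cs unfolded →
  terminates X cs (⊏-wellFounded (measure X cs)) (inj₁ (unfoldings-solved X unfolded))
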